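{- Let $R$ be a commutative ring and let $r<s$ be positive integers of opposite parity. Let $(h_n)_{n>0}$ and $(h'_n)_{n>0}$ be two sequences in $R$ that both satisfy $E(2r+i,r+i,r,0)$ and $E(s+r+i,r+i,r,0)$ for all positive integers $i$. Suppose $h_n=h'_n$ for all positive $n\le 3r$ with $n\equiv r\pmod 2$ and for all positive $n\le s+2r$ with $n\equiv s\pmod 2$, and suppose $h_sh_r$ is not a zero-divisor. Then $h=h'$.
   Context: For a sequence $h=(h_n)_{n>0}$ in a commutative ring and integers $a>b>c>d\ge0$, the elliptic relation $E(a,b,c,d)$ is the identity $$h_{a+b}h_{a-b}h_{c+d}h_{c-d}=h_{a+c}h_{a-c}h_{b+d}h_{b-d}-h_{b+c}h_{b-c}h_{a+d}h_{a-d}.$$ Explicitly, $E(2r+i,r+i,r,0)$ reads $h_{3r+2i}h_r^3=h_{3r+i}h_{r+i}^3-h_{2r+i}^3h_i$ and $E(s+r+i,r+i,r,0)$ reads $h_{s+2r+2i}h_sh_r^2=h_{s+2r+i}h_{s+i}h_{r+i}^2-h_{2r+i}h_{s+r+i}^2h_i$. -}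

module Defs where

open import Level using (Level)
open import Data.Nat using (ℕ; _∸_; _≤_)
import Data.Nat as ℕ
open import Data.Product using (_×_)
open import Relation.Binary.PropositionalEquality using (_≡_)
open import Algebra.Bundles using (CommutativeRing)

-- Sequences (h_n)_{n>0} are represented as functions ℕ → R; the value at 0
-- is irrelevant and never used.

module _ {c ℓ : Level} (R : CommutativeRing c ℓ) where
  open CommutativeRing R renaming (Carrier to A)

  -- The elliptic relation E(a,b,c,d) for h, meant for a > b > c > d ≥ 0
  -- (so all the subtractions below are genuine).
  Ell : (ℕ → A) → ℕ → ℕ → ℕ → ℕ → Set ℓ
  Ell h a b c d =
    h (a ℕ.+ b) * h (a ∸ b) * h (c ℕ.+ d) * h (c ∸ d)
      ≈ h (a ℕ.+ c) * h (a ∸ c) * h (b ℕ.+ d) * h (b ∸ d)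
        - h (b ℕ.+ c) * h (b ∸ c) * h (a ℕ.+ d) * h (a ∸ d)

  SatisfiesRS : ℕ → ℕ → (ℕ → A) → Set ℓ
  SatisfiesRS r s h =
    (i : ℕ) → 1 ≤ i →
      Ell h (2 ℕ.* r ℕ.+ i) (r ℕ.+ i) r 0 × Ell h (s ℕ.+ r ℕ.+ i) (r ℕ.+ i) r 0

  NonZeroDivisor : A → Set (c Level.⊔ ℓ)
  NonZeroDivisor x = (y : A) → x * y ≈ 0# → y ≈ 0#

{-# OPTIONS --safe #-}
-- An index of the parity of r above 3r is (2r+i) + (r+i) with i > 0, and
-- one of the parity of s above s + 2r is (s+r+i) + (r+i); the relations E(2r+i, r+i, r, 0) and
-- E(s+r+i, r+i, r, 0) express h_n h_r³, resp. h_n h_s h_r², through h at smaller positive indices.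
-- As r and s have opposite parities, every n is of one of these kinds or covered by the hypotheses,
-- and h_r, h_s can be cancelled because h_s h_r is not a zero-divisor.
module Submission where

open import Defs
open import Level using (Level)
open import Data.Nat using (ℕ; zero; suc; _+_; _*_; _∸_; _≤_; _<_; _%_; _/_; z≤n; s≤s; z<s; _≤?_)
open import Data.Nat.Properties
  using (<⇒≤; ≰⇒>; <-irrefl; <-trans; ≤-<-trans; <-≤-trans; m≤m+n; m<m+n; m<n+m; +-monoʳ-<; +-mono-<;
         m∸n≤m; m<n⇒0<n∸m; m+n∸n≡m; m+[n∸m]≡n; [m+n]∸[m+o]≡n∸o; *-distribʳ-∸)
import Data.Nat.Properties as ℕₚ
open import Data.Nat.DivMod using (m≡m%n+[m/n]*n; m%n<n; [m+kn]%n≡m%n)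
open import Data.Nat.Induction using (<-rec)
open import Data.Nat.Tactic.RingSolver using (solve-∀)
open import Data.Product using (_×_; _,_; proj₁; proj₂; ∃-syntax)
open import Data.Sum using (_⊎_; inj₁; inj₂)
open import Relation.Nullary using (yes; no; contradiction)
open import Relation.Binary.PropositionalEquality using (_≡_; _≢_; cong; cong₂; module ≡-Reasoning)
import Relation.Binary.PropositionalEquality as ≡
open import Algebra.Bundles using (CommutativeRing)

[m+2i]%2≡m%2 : ∀ m i → (m + 2 * i) % 2 ≡ m % 2
[m+2i]%2≡m%2 m i = ≡.trans (cong (λ k → (m + k) % 2) (ℕₚ.*-comm 2 i)) ([m+kn]%n≡m%n m i 2)

<2-pigeonhole : ∀ {x y z} → x < 2 → y < 2 → z < 2 → y ≢ z → x ≡ y ⊎ x ≡ z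
<2-pigeonhole {0} {0} _ _ _ _ = inj₁ ≡.refl
<2-pigeonhole {1} {1} _ _ _ _ = inj₁ ≡.refl
<2-pigeonhole {0} {1} {0} _ _ _ _ = inj₂ ≡.refl
<2-pigeonhole {1} {0} {1} _ _ _ _ = inj₂ ≡.refl
<2-pigeonhole {0} {1} {1} _ _ _ y≢z = contradiction ≡.refl y≢z
<2-pigeonhole {1} {0} {0} _ _ _ y≢z = contradiction ≡.refl y≢z
<2-pigeonhole {suc (suc _)} (s≤s (s≤s ())) _ _ _
<2-pigeonhole {_} {suc (suc _)} _ (s≤s (s≤s ())) _ _
<2-pigeonhole {_} {_} {suc (suc _)} _ _ (s≤s (s≤s ())) _

%2≡⊎%2≡ : ∀ m n → m % 2 ≢ n % 2 → ∀ k → k % 2 ≡ m % 2 ⊎ k % 2 ≡ n % 2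
%2≡⊎%2≡ m n m≢n k = <2-pigeonhole (m%n<n k 2) (m%n<n m 2) (m%n<n n 2) m≢n

≡-mod-2⇒∸≡*2 : ∀ m n → n % 2 ≡ m % 2 → n ∸ m ≡ (n / 2 ∸ m / 2) * 2
≡-mod-2⇒∸≡*2 m n eq = begin
  n ∸ m                                      ≡⟨ cong₂ _∸_ (m≡m%n+[m/n]*n n 2) (m≡m%n+[m/n]*n m 2) ⟩
  (n % 2 + n / 2 * 2) ∸ (m % 2 + m / 2 * 2)  ≡⟨ cong (λ k → (k + n / 2 * 2) ∸ (m % 2 + m / 2 * 2)) eq ⟩
  (m % 2 + n / 2 * 2) ∸ (m % 2 + m / 2 * 2)  ≡⟨ [m+n]∸[m+o]≡n∸o (m % 2) (n / 2 * 2) (m / 2 * 2) ⟩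
  n / 2 * 2 ∸ m / 2 * 2                      ≡⟨ *-distribʳ-∸ 2 (n / 2) (m / 2) ⟨
  (n / 2 ∸ m / 2) * 2                        ∎
  where open ≡-Reasoning

≡-mod-2⇒≤⊎≡+2* : ∀ m n → n % 2 ≡ m % 2 → n ≤ m ⊎ ∃[ i ] 0 < i × n ≡ m + 2 * i
≡-mod-2⇒≤⊎≡+2* m n eq with n ≤? m
... | yes n≤m = inj₁ n≤m
... | no n≰m = inj₂ (i , positive i n≡m+2i , n≡m+2i)
  where
  m<n = ≰⇒> n≰m
  i = n / 2 ∸ m / 2
  n≡m+2i : n ≡ m + 2 * i
  n≡m+2i = ≡.trans (≡.sym (m+[n∸m]≡n (<⇒≤ m<n)))
                 (cong (m +_) (≡.trans (≡-mod-2⇒∸≡*2 m n eq) (ℕₚ.*-comm i 2)))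
  positive : ∀ j → n ≡ m + 2 * j → 0 < j
  positive zero n≡m+0 = contradiction m<n (<-irrefl (≡.sym (≡.trans n≡m+0 (ℕₚ.+-identityʳ m))))
  positive (suc j) _ = z<s

module _ {c ℓ : Level} (R : CommutativeRing c ℓ) where
  open CommutativeRing R renaming (Carrier to A; _*_ to _·_; _+_ to _+ᴿ_)
  open import Algebra.Properties.Ring ring using (x[y-z]≈xy-xz; x∙y⁻¹≈ε⇒x≈y)
  open import Relation.Binary.Reasoning.Setoid setoid

  nonZeroDivisor-cancelʳ : ∀ {k x y} → NonZeroDivisor R k → x · k ≈ y · k → x ≈ y
  nonZeroDivisor-cancelʳ {k} {x} {y} nzd xk≈yk = x∙y⁻¹≈ε⇒x≈y x y (nzd (x - y) (begin
    k · (x - y)    ≈⟨ x[y-z]≈xy-xz k x y ⟩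
    k · x - k · y  ≈⟨ +-congʳ (trans (*-comm k x) (trans xk≈yk (*-comm y k))) ⟩
    k · y - k · y  ≈⟨ -‿inverseʳ (k · y) ⟩
    0#             ∎))

  nonZeroDivisor-*ʳ : ∀ {x y} → NonZeroDivisor R (x · y) → NonZeroDivisor R y
  nonZeroDivisor-*ʳ {x} {y} nzd z yz≈0 = nzd z (begin
    x · y · z    ≈⟨ *-assoc x y z ⟩
    x · (y · z)  ≈⟨ *-congˡ yz≈0 ⟩
    x · 0#       ≈⟨ zeroʳ x ⟩
    0#           ∎)

  nonZeroDivisor-*ˡ : ∀ {x y} → NonZeroDivisor R (x · y) → NonZeroDivisor R x
  nonZeroDivisor-*ˡ {x} {y} nzd = nonZeroDivisor-*ʳ (λ z yxz≈0 → nzd z (trans (*-congʳ (*-comm x y)) yxz≈0))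

  *-cong₄ : ∀ {x y z w x' y' z' w'} → x ≈ x' → y ≈ y' → z ≈ z' → w ≈ w' → x · y · z · w ≈ x' · y' · z' · w'
  *-cong₄ x≈ y≈ z≈ w≈ = *-cong (*-cong (*-cong x≈ y≈) z≈) w≈

  AgreeBelow : (ℕ → A) → (ℕ → A) → ℕ → Set ℓ
  AgreeBelow h h' n = ∀ m → 0 < m → m < n → h m ≈ h' m

  agree-by-strong-induction : ∀ {h h'} → (∀ n → 0 < n → AgreeBelow h h' n → h n ≈ h' n) →
                              ∀ n → 0 < n → h n ≈ h' n
  agree-by-strong-induction {h} {h'} step =
    <-rec (λ n → 0 < n → h n ≈ h' n) (λ n rec 0<n → step n 0<n (λ m 0<m m<n → rec m<n 0<m))

  -- Every index in E(a,b,c,d) other than a + b is positive and below a + b.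
  Ell-determines-a+b : ∀ {h h' a b c d n} → d < c → c < b → b < a → a + b ≡ n →
    Ell R h a b c d → Ell R h' a b c d →
    NonZeroDivisor R (h (a ∸ b)) → NonZeroDivisor R (h (c + d)) → NonZeroDivisor R (h (c ∸ d)) →
    AgreeBelow h h' n → h n ≈ h' n
  Ell-determines-a+b {h} {h'} {a} {b} {c} {d} d<c c<b b<a ≡.refl E E' nzd₁ nzd₂ nzd₃ agree =
    nonZeroDivisor-cancelʳ nzd₁ (nonZeroDivisor-cancelʳ nzd₂ (nonZeroDivisor-cancelʳ nzd₃ (begin
      h (a + b) · h (a ∸ b) · h (c + d) · h (c ∸ d)      ≈⟨ E ⟩
      _                                                  ≈⟨ +-cong rhs₁ (-‿cong rhs₂) ⟩
      _                                                  ≈⟨ E' ⟨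
      h' (a + b) · h' (a ∸ b) · h' (c + d) · h' (c ∸ d)  ≈⟨ *-cong₄ refl (sym lhs₁) (sym lhs₂) (sym lhs₃) ⟩
      h' (a + b) · h (a ∸ b) · h (c + d) · h (c ∸ d)     ∎)))
    where
    0<c = ≤-<-trans z≤n d<c
    0<b = <-trans 0<c c<b
    0<a = <-trans 0<b b<a
    d<b = <-trans d<c c<b
    c<a = <-trans c<b b<a
    d<a = <-trans d<b b<a
    a<N = m<m+n a 0<b
    b<N = m<n+m b 0<a
    c<N = <-trans c<b b<N
    a+c<N = +-monoʳ-< a c<b
    a+d<N = +-monoʳ-< a d<b
    b+c<N = +-mono-< b<a c<b
    b+d<N = +-mono-< b<a d<b
    c+d<N = +-mono-< c<a d<b
    agree-+ : ∀ {x y} → 0 < x → x + y < a + b → h (x + y) ≈ h' (x + y)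
    agree-+ {x} {y} 0<x x+y<N = agree (x + y) (<-≤-trans 0<x (m≤m+n x y)) x+y<N
    agree-∸ : ∀ {x y} → y < x → x < a + b → h (x ∸ y) ≈ h' (x ∸ y)
    agree-∸ {x} {y} y<x x<N = agree (x ∸ y) (m<n⇒0<n∸m y<x) (≤-<-trans (m∸n≤m x y) x<N)
    lhs₁ = agree-∸ b<a a<N
    lhs₂ = agree-+ 0<c c+d<N
    lhs₃ = agree-∸ d<c c<N
    rhs₁ = *-cong₄ (agree-+ 0<a a+c<N) (agree-∸ c<a a<N) (agree-+ 0<b b+d<N) (agree-∸ d<b b<N)
    rhs₂ = *-cong₄ (agree-+ 0<b b+c<N) (agree-∸ c<b b<N) (agree-+ 0<a a+d<N) (agree-∸ d<a a<N)

  module _ {r s : ℕ} {h h' : ℕ → A} (0<r : 0 < r) (E : SatisfiesRS R r s h) (E' : SatisfiesRS R r s h')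
           (nzd-r : NonZeroDivisor R (h r)) where

    private
      nzd-at : ∀ {m k} → m ≡ k → NonZeroDivisor R (h k) → NonZeroDivisor R (h m)
      nzd-at m≡k = ≡.subst (λ k → NonZeroDivisor R (h k)) (≡.sym m≡k)

    agree-at-3r+2i : ∀ i → 0 < i → AgreeBelow h h' (3 * r + 2 * i) → h (3 * r + 2 * i) ≈ h' (3 * r + 2 * i)
    agree-at-3r+2i i 0<i =
      Ell-determines-a+b 0<r (m<m+n r 0<i) b<a (a+b≡ r i) (proj₁ (E i 0<i)) (proj₁ (E' i 0<i))
        (nzd-at a∸b≡r nzd-r) (nzd-at (ℕₚ.+-identityʳ r) nzd-r) nzd-r
      where
      a≡r+b : ∀ r i → 2 * r + i ≡ r + (r + i)
      a≡r+b = solve-∀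
      a+b≡ : ∀ r i → 2 * r + i + (r + i) ≡ 3 * r + 2 * i
      a+b≡ = solve-∀
      a∸b≡r : 2 * r + i ∸ (r + i) ≡ r
      a∸b≡r = ≡.trans (cong (_∸ (r + i)) (a≡r+b r i)) (m+n∸n≡m r (r + i))
      b<a : r + i < 2 * r + i
      b<a = ≡.subst (r + i <_) (≡.sym (a≡r+b r i)) (m<n+m (r + i) 0<r)

    agree-at-s+2r+2i : 0 < s → NonZeroDivisor R (h s) →
      ∀ i → 0 < i → AgreeBelow h h' (s + 2 * r + 2 * i) → h (s + 2 * r + 2 * i) ≈ h' (s + 2 * r + 2 * i)
    agree-at-s+2r+2i 0<s nzd-s i 0<i =
      Ell-determines-a+b 0<r (m<m+n r 0<i) b<a (a+b≡ s r i) (proj₂ (E i 0<i)) (proj₂ (E' i 0<i))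
        (nzd-at a∸b≡s nzd-s) (nzd-at (ℕₚ.+-identityʳ r) nzd-r) nzd-r
      where
      a+b≡ : ∀ s r i → s + r + i + (r + i) ≡ s + 2 * r + 2 * i
      a+b≡ = solve-∀
      a∸b≡s : s + r + i ∸ (r + i) ≡ s
      a∸b≡s = ≡.trans (cong (_∸ (r + i)) (ℕₚ.+-assoc s r i)) (m+n∸n≡m s (r + i))
      b<a : r + i < s + r + i
      b<a = ≡.subst (r + i <_) (≡.sym (ℕₚ.+-assoc s r i)) (m<n+m (r + i) 0<s)

proposition3p2 : ∀ {c ℓ} (R : CommutativeRing c ℓ) (r s : ℕ) →
    1 ≤ r → r < s → r % 2 ≢ s % 2 →
    (h h' : ℕ → CommutativeRing.Carrier R) →
    SatisfiesRS R r s h → SatisfiesRS R r s h' →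
    ((n : ℕ) → 1 ≤ n → n ≤ 3 * r → n % 2 ≡ r % 2 → CommutativeRing._≈_ R (h n) (h' n)) →
    ((n : ℕ) → 1 ≤ n → n ≤ s + 2 * r → n % 2 ≡ s % 2 → CommutativeRing._≈_ R (h n) (h' n)) →
    NonZeroDivisor R (CommutativeRing._*_ R (h s) (h r)) →
    (n : ℕ) → 1 ≤ n → CommutativeRing._≈_ R (h n) (h' n)
proposition3p2 R r s 0<r r<s r≢s h h' E E' agree-r agree-s nzd = agree-by-strong-induction R step
  where
  open CommutativeRing R using (_≈_)
  nzd-r = nonZeroDivisor-*ʳ R nzd
  nzd-s = nonZeroDivisor-*ˡ R nzd
  step : ∀ n → 0 < n → AgreeBelow R h h' n → h n ≈ h' n
  step n 0<n with %2≡⊎%2≡ r s r≢s n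
  ... | inj₁ n≡r with ≡-mod-2⇒≤⊎≡+2* (3 * r) n (≡.trans n≡r (≡.sym ([m+2i]%2≡m%2 r r)))
  ...   | inj₁ n≤3r = λ _ → agree-r n 0<n n≤3r n≡r
  ...   | inj₂ (i , 0<i , ≡.refl) = agree-at-3r+2i R 0<r E E' nzd-r i 0<i
  step n 0<n | inj₂ n≡s with ≡-mod-2⇒≤⊎≡+2* (s + 2 * r) n (≡.trans n≡s (≡.sym ([m+2i]%2≡m%2 s r)))
  ...   | inj₁ n≤s+2r = λ _ → agree-s n 0<n n≤s+2r n≡s
  ...   | inj₂ (i , 0<i , ≡.refl) = agree-at-s+2r+2i R 0<r E E' nzd-r (<-trans 0<r r<s) nzd-s i 0<i
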